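{- Let $X$ be a complete lattice, $O$ a quasi-overlap function on $X$ and $\rho$ a Scott-automorphism of $X$. Let $I_O(x,y)=\sup\{t\in X\mid O(x,t)\leq y\}$, let $O^{\rho}(x,y)=\rho^{ -1}(O(\rho(x),\rho(y)))$, let $I_{O^{\rho}}(x,y)=\sup\{t\in X\mid O^{\rho}(x,t)\leq y\}$, and let $I_O^{\rho}(x,y)=\rho^{ -1}(I_O(\rho(x),\rho(y)))$. Then $I_O^{\rho}(x,y)=I_{O^{\rho}}(x,y)$ for all $x,y\in X$.
   Context: $X$ has bottom $0$ and top $1$. A quasi-overlap function on $X$ is $O:X^2\to X$ with (OL1) $O(x,y)=O(y,x)$; (OL2) $O(x,y)=0$ iff $x=0$ or $y=0$; (OL3) $O(x,y)=1$ iff $x=y=1$; (OL4) $O$ non-decreasing in each variable. A Scott-automorphism is a map $\rho:X\to X$ that is bijective, continuous with respect to the Scott topology (open sets: upward closed sets $A$ such that every directed $D$ with $\sup D\in A$ meets $A$), and satisfies $x\leq y\iff\rho(x)\leq\rho(y)$. -}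

module Defs where

open import Level using (Level; _⊔_)
open import Relation.Binary.Bundles using (Poset)
open import Relation.Unary using (Pred)
open import Data.Product using (Σ; _×_; _,_; proj₁; ∃)
open import Data.Sum using (_⊎_)
open import Function.Bundles using (_⇔_)

record CompleteLattice {c ℓ₁ ℓ₂ : Level} (P : Poset c ℓ₁ ℓ₂) : Set (c ⊔ Level.suc ℓ₂) where
  open Poset P
  field
    ⋁          : Pred Carrier ℓ₂ → Carrier
    ⋁-upper    : (S : Pred Carrier ℓ₂) → ∀ {x} → S x → x ≤ ⋁ S
    ⋁-least    : (S : Pred Carrier ℓ₂) → ∀ {z} → (∀ {x} → S x → x ≤ z) → ⋁ S ≤ z
    bot top    : Carrier
    bot-least  : ∀ x → bot ≤ x
    top-great  : ∀ x → x ≤ top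

module _ {c ℓ₁ ℓ₂ : Level} {P : Poset c ℓ₁ ℓ₂} (L : CompleteLattice P) where
  open Poset P
  open CompleteLattice L

  record IsQuasiOverlap (O : Carrier → Carrier → Carrier) : Set (c ⊔ ℓ₁ ⊔ ℓ₂) where
    field
      OL1 : ∀ x y → O x y ≈ O y x
      OL2 : ∀ x y → (O x y ≈ bot) ⇔ (x ≈ bot ⊎ y ≈ bot)
      OL3 : ∀ x y → (O x y ≈ top) ⇔ (x ≈ top × y ≈ top)
      OL4 : ∀ {x x′ y y′} → x ≤ x′ → y ≤ y′ → O x y ≤ O x′ y′

  IsDirected : Pred Carrier ℓ₂ → Set (c ⊔ ℓ₂)
  IsDirected D = (∃ λ d → D d) ×
                 (∀ {a b} → D a → D b → ∃ λ d → D d × (a ≤ d × b ≤ d))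

  IsScottOpen : Pred Carrier ℓ₂ → Set (c ⊔ Level.suc ℓ₂)
  IsScottOpen U = (∀ {x y} → x ≤ y → U x → U y) ×
                  ((D : Pred Carrier ℓ₂) → IsDirected D → U (⋁ D) → ∃ λ d → D d × U d)

  IsScottContinuous : (Carrier → Carrier) → Set (c ⊔ Level.suc ℓ₂)
  IsScottContinuous f = (U : Pred Carrier ℓ₂) → IsScottOpen U → IsScottOpen (λ x → U (f x))

  record ScottAutomorphism : Set (c ⊔ ℓ₁ ⊔ Level.suc ℓ₂) where
    field
      ρ          : Carrier → Carrier
      injective  : ∀ {x y} → ρ x ≈ ρ y → x ≈ y
      surjective : ∀ y → ∃ λ x → ρ x ≈ y
      continuous : IsScottContinuous ρ
      order-iff  : ∀ x y → (x ≤ y) ⇔ (ρ x ≤ ρ y)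
    ρ⁻¹ : Carrier → Carrier
    ρ⁻¹ y = proj₁ (surjective y)

  I[_] : (Carrier → Carrier → Carrier) → Carrier → Carrier → Carrier
  I[ O ] x y = ⋁ (λ t → O x t ≤ y)

  conj : ScottAutomorphism → (Carrier → Carrier → Carrier) → Carrier → Carrier → Carrier
  conj r F x y = ScottAutomorphism.ρ⁻¹ r (F (ScottAutomorphism.ρ r x) (ScottAutomorphism.ρ r y))

-- Proof idea: an order automorphism ρ commutes with suprema, ρ⁻¹ (⋁ S) ≈ ⋁ (S ∘ ρ), and
-- ρ⁻¹ is its own Galois adjoint, ρ⁻¹ z ≤ y ⇔ z ≤ ρ y. The latter rewrites the residuation
-- set of O^ρ at (x, y) into the residuation set of O at (ρ x, ρ y) precomposed with ρ,
-- and the former then moves ρ⁻¹ inside the supremum. Only monotonicity (OL4) of O in its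
-- second argument and the order-isomorphism part of ρ are used.
module Submission where

open import Defs
open import Level using (Level)
open import Relation.Binary.Bundles using (Poset)
open import Relation.Binary.Definitions using (_Respects_)
open import Relation.Unary using (Pred)
open import Data.Product using (proj₂)
open import Function.Bundles using (_⇔_; mk⇔; Equivalence)
open import Function.Properties.Equivalence using () renaming (sym to ⇔-sym)

module _ {c ℓ₁ ℓ₂ : Level} {P : Poset c ℓ₁ ℓ₂} (L : CompleteLattice P) where
  open Poset P
  open CompleteLattice L

  ⋁-monotone : {S T : Pred Carrier ℓ₂} → (∀ {t} → S t → T t) → ⋁ S ≤ ⋁ T
  ⋁-monotone S⊆T = ⋁-least _ λ t∈S → ⋁-upper _ (S⊆T t∈S)

  ⋁-cong : {S T : Pred Carrier ℓ₂} → (∀ t → S t ⇔ T t) → ⋁ S ≈ ⋁ T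
  ⋁-cong S⇔T = antisym (⋁-monotone (Equivalence.to (S⇔T _)))
                       (⋁-monotone (Equivalence.from (S⇔T _)))

  module OrderAutomorphism (r : ScottAutomorphism L) where
    open ScottAutomorphism r

    ρ-monotone : ∀ {a b} → a ≤ b → ρ a ≤ ρ b
    ρ-monotone = Equivalence.to (order-iff _ _)

    ρ-reflects-≤ : ∀ {a b} → ρ a ≤ ρ b → a ≤ b
    ρ-reflects-≤ = Equivalence.from (order-iff _ _)

    ρ∘ρ⁻¹≈id : ∀ z → ρ (ρ⁻¹ z) ≈ z
    ρ∘ρ⁻¹≈id z = proj₂ (surjective z)

    ρ⁻¹-≤⇔≤-ρ : ∀ z y → (ρ⁻¹ z ≤ y) ⇔ (z ≤ ρ y)
    ρ⁻¹-≤⇔≤-ρ z y = mk⇔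
      (λ ρ⁻¹z≤y → trans (reflexive (Eq.sym (ρ∘ρ⁻¹≈id z))) (ρ-monotone ρ⁻¹z≤y))
      (λ z≤ρy → ρ-reflects-≤ (trans (reflexive (ρ∘ρ⁻¹≈id z)) z≤ρy))

    ρ⁻¹-⋁ : (S : Pred Carrier ℓ₂) → S Respects _≈_ → ρ⁻¹ (⋁ S) ≈ ⋁ (λ t → S (ρ t))
    ρ⁻¹-⋁ S resp = antisym ρ⁻¹⋁S≤ ≤ρ⁻¹⋁S
      where
      ρ⁻¹⋁S≤ : ρ⁻¹ (⋁ S) ≤ ⋁ (λ t → S (ρ t))
      ρ⁻¹⋁S≤ = Equivalence.from (ρ⁻¹-≤⇔≤-ρ _ _) (⋁-least S λ {t} t∈S →
        Equivalence.to (ρ⁻¹-≤⇔≤-ρ _ _)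
          (⋁-upper _ (resp (Eq.sym (ρ∘ρ⁻¹≈id t)) t∈S)))

      ≤ρ⁻¹⋁S : ⋁ (λ t → S (ρ t)) ≤ ρ⁻¹ (⋁ S)
      ≤ρ⁻¹⋁S = ⋁-least _ λ ρt∈S →
        ρ-reflects-≤ (trans (⋁-upper S ρt∈S) (reflexive (Eq.sym (ρ∘ρ⁻¹≈id _))))

    residual-conj : (F : Carrier → Carrier → Carrier) →
                    (∀ {x t t′} → t ≤ t′ → F x t ≤ F x t′) →
                    ∀ x y → conj L r (I[_] L F) x y ≈ I[_] L (conj L r F) x y
    residual-conj F F-monotoneʳ x y = Eq.trans
      (ρ⁻¹-⋁ (λ t → F (ρ x) t ≤ ρ y)
        (λ t≈t′ Ft≤ρy → trans (F-monotoneʳ (reflexive (Eq.sym t≈t′))) Ft≤ρy))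
      (⋁-cong λ t → ⇔-sym (ρ⁻¹-≤⇔≤-ρ (F (ρ x) (ρ t)) y))

proposition4p2 : ∀ {c ℓ₁ ℓ₂ : Level} {P : Poset c ℓ₁ ℓ₂} (L : CompleteLattice P)
                 (O : Poset.Carrier P → Poset.Carrier P → Poset.Carrier P) →
                 IsQuasiOverlap L O → (r : ScottAutomorphism L) →
                 ∀ x y → Poset._≈_ P (conj L r (I[_] L O) x y) (I[_] L (conj L r O) x y)
proposition4p2 {P = P} L O isQuasiOverlap r =
  OrderAutomorphism.residual-conj L r O (OL4 (Poset.refl P))
  where open IsQuasiOverlap isQuasiOverlap
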